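{- Let $(\Sigma,\Gamma,\mathcal U)$ be a (pure) many-sorted finite model finding problem with a sort $A$. Enumerate $\mathcal U(A)$ as $a_1,\dots,a_m$ (distinct), and let $c_1,\dots,c_n$ be constant symbols of $\Sigma$ of sort $A$. Let $I$ be any interpretation of $(\Sigma,\Gamma,\mathcal U)$. Then there exists an interpretation $I'$ isomorphic to $I$ such that: (1) for every $k=1,\dots,\min\{m,n\}$, $I'$ satisfies $\bigvee_{i=1}^k c_k=a_i$, i.e. $I'(c_k)\in\{a_1,\dots,a_k\}$; and (2) for every $k=2,\dots,\min\{m,n\}$ and every $d=2,\dots,k$, $I'$ satisfies $(c_k=a_d)\implies\bigvee_{i=1}^{k-1} c_i=a_{d-1}$, i.e. if $I'(c_k)=a_d$ then $I'(c_i)=a_{d-1}$ for some $i\in\{1,\dots,k-1\}$.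
   Context: A signature $\Sigma$ consists of a finite set $\Theta(\Sigma)$ of sorts, a finite set of function symbols $f:A_1\times\dots\times A_n\to B$ ($A_i,B$ sorts; constants are the case $n=0$, written $c:B$), and a finite set of predicate symbols $R:A_1\times\dots\times A_n\to\mathrm{Bool}$. A domain assignment $\mathcal U$ maps each sort $\theta$ to a nonempty finite set $\mathcal U(\theta)$. A (pure) many-sorted finite model finding (MSFMF) problem is a triple $(\Sigma,\Gamma,\mathcal U)$ with $\Gamma$ a finite set of many-sorted first-order formulas (with equality) over $\Sigma$; domain elements do not occur in the formulas. An interpretation $I$ assigns each function symbol $f:A_1\times\dots\times A_n\to B$ a function $I(f):\mathcal U(A_1)\times\dots\times\mathcal U(A_n)\to\mathcal U(B)$ and each predicate symbol $R:A_1\times\dots\times A_n\to\mathrm{Bool}$ a relation $I(R)\subseteq\mathcal U(A_1)\times\dots\times\mathcal U(A_n)$. A domain permutation $\sigma$ is a family of permutations $\sigma_\theta$ of $\mathcal U(\theta)$, one for each sort $\theta$. It acts on interpretations by: $(\sigma\bullet I)(f)(\sigma_{A_1}(a_1),\dots,\sigma_{A_n}(a_n))=\sigma_B(I(f)(a_1,\dots,a_n))$, and $(a_1,\dots,a_n)\in I(R)$ iff $(\sigma_{A_1}(a_1),\dots,\sigma_{A_n}(a_n))\in(\sigma\bullet I)(R)$. Two interpretations $I,I'$ of a pure problem are isomorphic if $I'=\sigma\bullet I$ for some domain permutation $\sigma$. -}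

module Defs where

open import Data.Nat using (ℕ; NonZero)
open import Data.Fin using (Fin)
open import Data.Bool using (Bool)
open import Data.List using (List; [])
open import Data.List.Relation.Unary.All as All using (All; [])
open import Data.Fin.Permutation using (Permutation′; _⟨$⟩ʳ_)
open import Relation.Binary.PropositionalEquality using (_≡_; subst; sym)
open import Data.Product using (Σ; _×_; _,_)

record Signature : Set where
  field
    nSorts : ℕ
    nFun   : ℕ
    funArgs : Fin nFun → List (Fin nSorts)
    funRes  : Fin nFun → Fin nSorts
    nPred  : ℕ
    predArgs : Fin nPred → List (Fin nSorts)

module _ (Sig : Signature) where
  open Signature Sig

  record DomainAssignment : Set where
    field
      size : Fin nSorts → ℕ
      nonempty : (θ : Fin nSorts) → NonZero (size θ)

  module _ (𝒰 : DomainAssignment) where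
    open DomainAssignment 𝒰

    Dom : Fin nSorts → Set
    Dom θ = Fin (size θ)

    Tuple : List (Fin nSorts) → Set
    Tuple = All Dom

    record Interpretation : Set where
      field
        fun  : (f : Fin nFun) → Tuple (funArgs f) → Dom (funRes f)
        pred : (r : Fin nPred) → Tuple (predArgs r) → Bool

    DomainPermutation : Set
    DomainPermutation = (θ : Fin nSorts) → Permutation′ (size θ)

    applyTuple : DomainPermutation → {ts : List (Fin nSorts)} → Tuple ts → Tuple ts
    applyTuple σ = All.map (λ {θ} x → σ θ ⟨$⟩ʳ x)

    -- I' = σ • I, written out pointwise:
    --   I'(f)(σ a⃗) = σ(I(f)(a⃗))  and  a⃗ ∈ I(R) iff σ a⃗ ∈ I'(R).
    _IsActionOn_By_ : Interpretation → Interpretation → DomainPermutation → Set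
    I' IsActionOn I By σ =
      ((f : Fin nFun) (xs : Tuple (funArgs f)) →
         Interpretation.fun I' f (applyTuple σ xs) ≡ σ (funRes f) ⟨$⟩ʳ Interpretation.fun I f xs)
      × ((r : Fin nPred) (xs : Tuple (predArgs r)) →
         Interpretation.pred I' r (applyTuple σ xs) ≡ Interpretation.pred I r xs)

    Isomorphic : Interpretation → Interpretation → Set
    Isomorphic I I' = Σ DomainPermutation (λ σ → I' IsActionOn I By σ)

    IsConstantOfSort : Fin nFun → Fin nSorts → Set
    IsConstantOfSort c A = (funArgs c ≡ []) × (funRes c ≡ A)

    constVal : (I : Interpretation) (A : Fin nSorts) (c : Fin nFun) →
               IsConstantOfSort c A → Dom A
    constVal I A c (p , q) =
      subst Dom q (Interpretation.fun I c (subst Tuple (sym p) []))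

-- Relabel the domain of A so that the values of c₁, c₂, … receive the labels 0, 1, 2, …
-- in order of first occurrence: walking through the constants, a value not seen before
-- is swapped with the smallest unused label. Afterwards the label of cₖ is at most k, and
-- a label d + 1 is only used after d has been used by an earlier constant. Transporting I
-- along this relabelling, followed by the enumeration a, gives the required I′.
module Submission where

open import Defs
open import Data.Nat using (ℕ; zero; suc; _≤_; _<_; z≤n; _<?_)
open import Data.Nat.Properties
  using (≤-<-trans; <-trans; <-irrefl; ≮⇒≥; m<n⇒m<1+n; m<1+n⇒m<n∨m≡n; n<1+n)
open import Data.Nat.Induction using (<-rec)
open import Data.Fin using (Fin; toℕ; fromℕ<; _≟_)
open import Data.Fin.Patterns using (0F)
open import Data.Fin.Properties using (toℕ<n; toℕ-fromℕ<; fromℕ<-toℕ; toℕ-injective)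
open import Data.Fin.Permutation using (Permutation′; _⟨$⟩ʳ_; id; _∘ₚ_; flip; inverseˡ; transpose)
import Data.Fin.Permutation.Components as PC
open import Data.List using ([]; _∷_)
open import Data.List.Relation.Unary.All using ([]; _∷_)
open import Data.Product using (Σ; Σ-syntax; ∃-syntax; _×_; _,_; proj₁; proj₂)
open import Data.Sum using (inj₁; inj₂)
open import Function.Bundles using (Injection)
open import Function.Properties.Inverse using (↔⇒↣)
open import Relation.Binary.PropositionalEquality
  using (_≡_; _≢_; refl; sym; trans; cong; cong₂; subst)
open import Data.Empty using (⊥-elim)
open import Relation.Nullary using (¬_; yes; no)
open import Relation.Nullary.Decidable using (dec-true; dec-false; dec-yes-irr)
open import Axiom.UniquenessOfIdentityProofs using (module Decidable⇒UIP)

PredecessorClosed : (ℕ → ℕ) → ℕ → Set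
PredecessorClosed u k = ∀ {i d} → i < k → u i ≡ suc d → ∃[ j ] j < i × u j ≡ d

predecessorClosed⇒≤ : ∀ {u k} → PredecessorClosed u k → ∀ {i} → i < k → u i ≤ i
predecessorClosed⇒≤ {u} {k} closed {i} = <-rec (λ i → i < k → u i ≤ i) bound i
  where
    bound : ∀ i → (∀ {j} → j < i → j < k → u j ≤ j) → i < k → u i ≤ i
    bound i below i<k with u i in ui≡
    ... | zero = z≤n
    ... | suc d with closed i<k ui≡
    ...   | j , j<i , refl = ≤-<-trans (below j<i (<-trans j<i i<k)) j<i

record InitialLabelling (u : ℕ → ℕ) (r k : ℕ) : Set where
  field
    below  : ∀ {i} → i < k → u i < r
    onto   : ∀ {j} → j < r → ∃[ i ] i < k × u i ≡ j
    closed : PredecessorClosed u k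

open InitialLabelling

initialLabelling-empty : ∀ {u} → InitialLabelling u 0 0
initialLabelling-empty = record { below = λ () ; onto = λ () ; closed = λ () }

initialLabelling-reuse : ∀ {u r k} → InitialLabelling u r k → u k < r → InitialLabelling u r (suc k)
initialLabelling-reuse {u} {r} {k} L uk<r = record
  { below = below′
  ; onto = λ j<r → let (i , i<k , ui≡j) = onto L j<r in i , m<n⇒m<1+n i<k , ui≡j
  ; closed = closed′
  }
  where
    below′ : ∀ {i} → i < suc k → u i < r
    below′ i<1+k with m<1+n⇒m<n∨m≡n i<1+k
    ... | inj₁ i<k = below L i<k
    ... | inj₂ refl = uk<r
    closed′ : PredecessorClosed u (suc k)
    closed′ i<1+k ui≡1+d with m<1+n⇒m<n∨m≡n i<1+k
    ... | inj₁ i<k = closed L i<k ui≡1+d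
    ... | inj₂ refl = onto L (<-trans (subst (_ <_) (sym ui≡1+d) (n<1+n _)) uk<r)

initialLabelling-fresh : ∀ {u v r k} → InitialLabelling u r k →
  (∀ {i} → i < k → v i ≡ u i) → v k ≡ r → InitialLabelling v (suc r) (suc k)
initialLabelling-fresh {u} {v} {r} {k} L v≗u vk≡r = record
  { below = below′ ; onto = onto′ ; closed = closed′ }
  where
    below′ : ∀ {i} → i < suc k → v i < suc r
    below′ i<1+k with m<1+n⇒m<n∨m≡n i<1+k
    ... | inj₁ i<k = subst (_< suc r) (sym (v≗u i<k)) (m<n⇒m<1+n (below L i<k))
    ... | inj₂ refl = subst (_< suc r) (sym vk≡r) (n<1+n r)
    onto′ : ∀ {j} → j < suc r → ∃[ i ] i < suc k × v i ≡ j
    onto′ j<1+r with m<1+n⇒m<n∨m≡n j<1+r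
    ... | inj₁ j<r = let (i , i<k , ui≡j) = onto L j<r in i , m<n⇒m<1+n i<k , trans (v≗u i<k) ui≡j
    ... | inj₂ refl = k , n<1+n k , vk≡r
    closed′ : PredecessorClosed v (suc k)
    closed′ i<1+k vi≡1+d with m<1+n⇒m<n∨m≡n i<1+k
    ... | inj₁ i<k =
      let (j , j<i , uj≡d) = closed L i<k (trans (sym (v≗u i<k)) vi≡1+d)
      in j , j<i , trans (v≗u (<-trans j<i i<k)) uj≡d
    ... | inj₂ refl =
      let (j , j<k , uj≡d) = onto L (subst (_ <_) (trans (sym vi≡1+d) vk≡r) (n<1+n _))
      in j , j<k , trans (v≗u j<k) uj≡d

transpose-matchˡ : ∀ {m} (x y : Fin m) → PC.transpose x y x ≡ y
transpose-matchˡ x y rewrite dec-true (x ≟ x) refl = refl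

transpose-fixes : ∀ {m} {x y z : Fin m} → z ≢ x → z ≢ y → PC.transpose x y z ≡ z
transpose-fixes {x = x} {y} {z} z≢x z≢y rewrite dec-false (z ≟ x) z≢x | dec-false (z ≟ y) z≢y = refl

module _ {m : ℕ} (v : ℕ → Fin m) where

  labels : Permutation′ m → ℕ → ℕ
  labels ρ i = toℕ (ρ ⟨$⟩ʳ v i)

  -- Swapping the value at k with the first unused label r leaves earlier labels alone,
  -- since those are all below r ≤ labels ρ k.
  relabelFresh : ∀ {ρ r k} → InitialLabelling (labels ρ) r k → ¬ labels ρ k < r →
    Σ[ ρ′ ∈ Permutation′ m ] InitialLabelling (labels ρ′) (suc r) (suc k)
  relabelFresh {ρ} {r} {k} L lk≮r = ρ ∘ₚ transpose x y , initialLabelling-fresh L unchanged atK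
    where
      x : Fin m
      x = ρ ⟨$⟩ʳ v k
      r<m : r < m
      r<m = ≤-<-trans (≮⇒≥ lk≮r) (toℕ<n x)
      y : Fin m
      y = fromℕ< r<m
      atK : labels (ρ ∘ₚ transpose x y) k ≡ r
      atK = trans (cong toℕ (transpose-matchˡ x y)) (toℕ-fromℕ< r<m)
      unchanged : ∀ {i} → i < k → labels (ρ ∘ₚ transpose x y) i ≡ labels ρ i
      unchanged i<k = cong toℕ (transpose-fixes
        (λ ρvi≡x → lk≮r (subst (_< r) (cong toℕ ρvi≡x) (below L i<k)))
        (λ ρvi≡y → <-irrefl (trans (cong toℕ ρvi≡y) (toℕ-fromℕ< r<m)) (below L i<k)))

  canonicalLabelling : ∀ k → Σ[ ρ ∈ Permutation′ m ] ∃[ r ] InitialLabelling (labels ρ) r k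
  canonicalLabelling zero = id , 0 , initialLabelling-empty
  canonicalLabelling (suc k) with canonicalLabelling k
  ... | ρ , r , L with labels ρ k <? r
  ...   | yes lk<r = ρ , r , initialLabelling-reuse L lk<r
  ...   | no lk≮r = let (ρ′ , L′) = relabelFresh {ρ} {r} {k} L lk≮r in ρ′ , suc r , L′

extendℕ : ∀ {n} {A : Set} → A → (Fin n → A) → ℕ → A
extendℕ {n} default w i with i <? n
... | yes i<n = w (fromℕ< i<n)
... | no _ = default

extendℕ-toℕ : ∀ {n} {A : Set} (default : A) (w : Fin n → A) (k : Fin n) → extendℕ default w (toℕ k) ≡ w k
extendℕ-toℕ {n} default w k with toℕ k <? n
... | yes k<n = cong w (fromℕ<-toℕ k k<n)
... | no k≮n = ⊥-elim (k≮n (toℕ<n k))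

IsCanonical : ∀ {n m} → (Fin n → Fin m) → Set
IsCanonical {n} {m} w =
  (∀ k → toℕ (w k) ≤ toℕ k) ×
  (∀ k (d : Fin m) → toℕ (w k) ≡ suc (toℕ d) → ∃[ i ] toℕ i < toℕ k × w i ≡ d)

canonicalRelabelling : ∀ {n m} (w : Fin n → Fin m) → Σ[ ρ ∈ Permutation′ m ] IsCanonical (λ k → ρ ⟨$⟩ʳ w k)
canonicalRelabelling {zero} w = id , (λ ()) , (λ ())
canonicalRelabelling {suc n} {m} w with canonicalLabelling (extendℕ (w 0F) w) (suc n)
... | ρ , _ , L = ρ , bounded , predecessor
  where
    u : ℕ → Fin m
    u = extendℕ (w 0F) w
    closedρ : PredecessorClosed (labels u ρ) (suc n)
    closedρ = closed L
    labels-toℕ : ∀ k → labels u ρ (toℕ k) ≡ toℕ (ρ ⟨$⟩ʳ w k)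
    labels-toℕ k = cong (λ x → toℕ (ρ ⟨$⟩ʳ x)) (extendℕ-toℕ (w 0F) w k)
    bounded : ∀ k → toℕ (ρ ⟨$⟩ʳ w k) ≤ toℕ k
    bounded k = subst (_≤ toℕ k) (labels-toℕ k) (predecessorClosed⇒≤ closedρ (toℕ<n k))
    predecessor : ∀ k d → toℕ (ρ ⟨$⟩ʳ w k) ≡ suc (toℕ d) → ∃[ i ] toℕ i < toℕ k × ρ ⟨$⟩ʳ w i ≡ d
    predecessor k d wk≡1+d with closedρ (toℕ<n k) (trans (labels-toℕ k) wk≡1+d)
    ... | j , j<k , uj≡d = i , subst (_< toℕ k) (sym i≡j) j<k ,
      toℕ-injective (trans (sym (labels-toℕ i)) (trans (cong (labels u ρ) i≡j) uj≡d))
      where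
        j<1+n : j < suc n
        j<1+n = <-trans j<k (toℕ<n k)
        i : Fin (suc n)
        i = fromℕ< j<1+n
        i≡j : toℕ i ≡ j
        i≡j = toℕ-fromℕ< j<1+n

module DomainAction (Sig : Signature) (𝒰 : DomainAssignment Sig) where
  open Signature Sig
  open DomainAssignment 𝒰

  inverse : DomainPermutation Sig 𝒰 → DomainPermutation Sig 𝒰
  inverse σ θ = flip (σ θ)

  applyTuple-inverse : ∀ σ {ts} (xs : Tuple Sig 𝒰 ts) →
    applyTuple Sig 𝒰 (inverse σ) (applyTuple Sig 𝒰 σ xs) ≡ xs
  applyTuple-inverse σ [] = refl
  applyTuple-inverse σ {θ ∷ _} (x ∷ xs) = cong₂ _∷_ (inverseˡ (σ θ)) (applyTuple-inverse σ xs)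

  _•_ : DomainPermutation Sig 𝒰 → Interpretation Sig 𝒰 → Interpretation Sig 𝒰
  σ • I = record
    { fun = λ f xs → σ (funRes f) ⟨$⟩ʳ Interpretation.fun I f (applyTuple Sig 𝒰 (inverse σ) xs)
    ; pred = λ r xs → Interpretation.pred I r (applyTuple Sig 𝒰 (inverse σ) xs)
    }

  •-isActionOn : ∀ σ I → _IsActionOn_By_ Sig 𝒰 (σ • I) I σ
  •-isActionOn σ I =
    (λ f xs → cong (λ ys → σ (funRes f) ⟨$⟩ʳ Interpretation.fun I f ys) (applyTuple-inverse σ xs)) ,
    (λ r xs → cong (Interpretation.pred I r) (applyTuple-inverse σ xs))

  constVal-action : ∀ {σ I I′} → _IsActionOn_By_ Sig 𝒰 I′ I σ →
    ∀ {A c} (cA : IsConstantOfSort Sig 𝒰 c A) →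
    constVal Sig 𝒰 I′ A c cA ≡ σ A ⟨$⟩ʳ constVal Sig 𝒰 I A c cA
  constVal-action {σ} {I} {I′} (acts , _) {A} {c} (p , q) =
    atEmptyTuple (Interpretation.fun I′ c) (Interpretation.fun I c) (acts c) p q
    where
      atEmptyTuple : ∀ {ts B} (F′ F : Tuple Sig 𝒰 ts → Dom Sig 𝒰 B) →
        (∀ xs → F′ (applyTuple Sig 𝒰 σ xs) ≡ σ B ⟨$⟩ʳ F xs) → (p : ts ≡ []) (q : B ≡ A) →
        subst (Dom Sig 𝒰) q (F′ (subst (Tuple Sig 𝒰) (sym p) [])) ≡
          σ A ⟨$⟩ʳ subst (Dom Sig 𝒰) q (F (subst (Tuple Sig 𝒰) (sym p) []))
      atEmptyTuple F′ F acts refl refl = acts []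

  onSort : (A : Fin nSorts) → Permutation′ (size A) → DomainPermutation Sig 𝒰
  onSort A π θ with θ ≟ A
  ... | yes refl = π
  ... | no _ = id

  onSort-at : ∀ A π x → onSort A π A ⟨$⟩ʳ x ≡ π ⟨$⟩ʳ x
  onSort-at A π x rewrite dec-yes-irr (A ≟ A) (Decidable⇒UIP.≡-irrelevant _≟_) refl = refl

mainTheorem1 : (Sig : Signature) (𝒰 : DomainAssignment Sig)
    (A : Fin (Signature.nSorts Sig))
    (a : Permutation′ (DomainAssignment.size 𝒰 A))
    (n : ℕ) (c : Fin n → Fin (Signature.nFun Sig))
    (cA : (k : Fin n) → IsConstantOfSort Sig 𝒰 (c k) A)
    (I : Interpretation Sig 𝒰) →
    Σ (Interpretation Sig 𝒰) λ I' →
      Isomorphic Sig 𝒰 I I'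
      × ((k : Fin n) → toℕ k < DomainAssignment.size 𝒰 A →
          Σ (Fin (DomainAssignment.size 𝒰 A)) λ i →
            toℕ i ≤ toℕ k × constVal Sig 𝒰 I' A (c k) (cA k) ≡ a ⟨$⟩ʳ i)
      × ((k : Fin n) → toℕ k < DomainAssignment.size 𝒰 A →
          (d e : Fin (DomainAssignment.size 𝒰 A)) →
          toℕ e ≡ suc (toℕ d) → toℕ e ≤ toℕ k →
          constVal Sig 𝒰 I' A (c k) (cA k) ≡ a ⟨$⟩ʳ e →
          Σ (Fin n) λ i →
            toℕ i < toℕ k × constVal Sig 𝒰 I' A (c i) (cA i) ≡ a ⟨$⟩ʳ d)
mainTheorem1 Sig 𝒰 A a n c cA I =
  σ • I , (σ , •-isActionOn σ I) ,
  (λ k _ → ρ ⟨$⟩ʳ value k , proj₁ canonical k , value′ k) ,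
  λ k _ d e e≡1+d _ v′k≡ae →
    let ρvk≡e = Injection.injective (↔⇒↣ a) (trans (sym (value′ k)) v′k≡ae)
        (i , i<k , ρvi≡d) = proj₂ canonical k d (trans (cong toℕ ρvk≡e) e≡1+d)
    in i , i<k , trans (value′ i) (cong (a ⟨$⟩ʳ_) ρvi≡d)
  where
    open DomainAction Sig 𝒰
    value : Fin n → Fin (DomainAssignment.size 𝒰 A)
    value k = constVal Sig 𝒰 I A (c k) (cA k)
    ρ : Permutation′ (DomainAssignment.size 𝒰 A)
    ρ = proj₁ (canonicalRelabelling value)
    canonical : IsCanonical (λ k → ρ ⟨$⟩ʳ value k)
    canonical = proj₂ (canonicalRelabelling value)
    σ : DomainPermutation Sig 𝒰
    σ = onSort A (ρ ∘ₚ a)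
    value′ : ∀ k → constVal Sig 𝒰 (σ • I) A (c k) (cA k) ≡ a ⟨$⟩ʳ (ρ ⟨$⟩ʳ value k)
    value′ k = trans (constVal-action {σ} {I} {σ • I} (•-isActionOn σ I) (cA k)) (onSort-at A (ρ ∘ₚ a) (value k))
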